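{- Let $G=(V,E)$ be a graph, $c\ge1$, $\epsilon\in[0,1/3)$, and let $\kappa(G)$ be an $(\epsilon,c)$-kernel of $G$. If $M$ is a matching in $\kappa(G)$ such that every augmenting path in $\kappa(G)$ with respect to $M$ has length at least five, then $M$ is a $(3+3\epsilon)$-approximation to the maximum matching in $G$, i.e., every matching of $G$ has at most $(3+3\epsilon)|M|$ edges.
   Context: For $v\in V$ let $\mathcal{N}_v$ be its neighbors in $G$. A subgraph $\kappa(G)=(V,\kappa(E))$ with $\kappa(E)\subseteq E$, together with a partition of $V$ into tight nodes $\kappa_T(V)$ and slack nodes $\kappa_S(V)$, is an $(\epsilon,c)$-kernel of $G$ if, with $\kappa(\mathcal{N}_v)=\{u\in\mathcal{N}_v:(u,v)\in\kappa(E)\}$: (i) $|\kappa(\mathcal{N}_v)|\le(1+\epsilon)c$ for all $v\in V$; (ii) $|\kappa(\mathcal{N}_v)|\ge(1-\epsilon)c$ for all $v\in\kappa_T(V)$; (iii) every edge of $G$ joining two slack nodes lies in $\kappa(E)$. An augmenting path with respect to a matching $M$ is a simple path whose endpoints are unmatched in $M$ and whose edges alternate between non-$M$ and $M$ edges; its length is its number of edges.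
   Formalization: The kernel parameters $c$ and $\epsilon$ are rational. -}

module Defs where

open import Data.Bool using (Bool; true; false; if_then_else_)
open import Data.Nat as ℕ using (ℕ)
open import Data.Fin using (Fin)
open import Data.List using (List; []; _∷_; length; map; allFin; head; last)
open import Data.Nat.ListAction using (sum)
open import Data.List.Relation.Unary.Any using (Any)
open import Data.List.Relation.Unary.All using (All)
open import Data.List.Relation.Unary.Unique.Propositional using (Unique)
open import Data.Maybe using (just)
open import Data.Product using (_×_; _,_; proj₁; proj₂)
open import Data.Sum using (_⊎_)
open import Data.Unit using (⊤)
open import Data.Integer using (+_)
open import Data.Rational using (ℚ; _/_; _+_; _*_; _≤_; _<_; 0ℚ; 1ℚ)
open import Relation.Binary.PropositionalEquality using (_≡_)
open import Relation.Nullary using (¬_)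

toℚ : ℕ → ℚ
toℚ k = + k / 1

record Graph (n : ℕ) : Set where
  field
    adj   : Fin n → Fin n → Bool
    sym   : ∀ u v → adj u v ≡ adj v u
    irrefl : ∀ v → adj v v ≡ false
open Graph public

EdgeSet : ℕ → Set
EdgeSet n = Fin n → Fin n → Bool

deg : ∀ {n} → EdgeSet n → Fin n → ℕ
deg {n} K v = sum (map (λ u → if K u v then 1 else 0) (allFin n))

-- (ε,c)-kernel: subgraph κ(E) ⊆ E and a tight/slack partition
-- (tight v ≡ true : v ∈ κ_T(V); tight v ≡ false : v ∈ κ_S(V)).
record Kernel {n : ℕ} (G : Graph n) (ε c : ℚ) : Set where
  field
    kE       : EdgeSet n
    kE-sym   : ∀ u v → kE u v ≡ kE v u
    kE⊆E     : ∀ u v → kE u v ≡ true → adj G u v ≡ true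
    tight    : Fin n → Bool
    upper    : ∀ v → toℚ (deg kE v) ≤ (1ℚ + ε) * c
    lower    : ∀ v → tight v ≡ true → (1ℚ Data.Rational.- ε) * c ≤ toℚ (deg kE v)
    slackAll : ∀ u v → adj G u v ≡ true → tight u ≡ false → tight v ≡ false
               → kE u v ≡ true
open Kernel public

Matching : ℕ → Set
Matching n = List (Fin n × Fin n)

endpoints : ∀ {n} → Matching n → List (Fin n)
endpoints [] = []
endpoints ((u , v) ∷ M) = u ∷ v ∷ endpoints M

-- M is a matching in the edge relation A: every edge of M is an edge of A,
-- and the edges are pairwise vertex-disjoint (all endpoints distinct; this
-- also excludes loops and repeated edges).
IsMatchingIn : ∀ {n} → EdgeSet n → Matching n → Set
IsMatchingIn A M = All (λ e → A (proj₁ e) (proj₂ e) ≡ true) M × Unique (endpoints M)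

InM : ∀ {n} → Matching n → Fin n → Fin n → Set
InM M u v = Any (λ e → (e ≡ (u , v)) ⊎ (e ≡ (v , u))) M

Matched : ∀ {n} → Matching n → Fin n → Set
Matched M v = Any (λ w → w ≡ v) (endpoints M)

-- Alternation along a vertex sequence: the flag says whether the next edge
-- must be an M-edge; every consecutive pair must be an edge of A.
AltFrom : ∀ {n} → EdgeSet n → Matching n → Bool → List (Fin n) → Set
AltFrom A M b [] = ⊤
AltFrom A M b (x ∷ []) = ⊤
AltFrom A M true  (x ∷ y ∷ ps) = A x y ≡ true × InM M x y × AltFrom A M false (y ∷ ps)
AltFrom A M false (x ∷ y ∷ ps) = A x y ≡ true × ¬ InM M x y × AltFrom A M true (y ∷ ps)

-- Its length (number of edges) is  length ps ∸ 1.
AugmentingPath : ∀ {n} → EdgeSet n → Matching n → List (Fin n) → Set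
AugmentingPath A M ps =
  Unique ps × 2 ℕ.≤ length ps × AltFrom A M false ps
  × (∀ x → head ps ≡ just x → ¬ Matched M x)
  × (∀ x → last ps ≡ just x → ¬ Matched M x)

module Submission where

-- Call a vertex free if it is unmatched in M and tight. Two unmatched slack vertices adjacent in G
-- are adjacent in κ(G), which would be an augmenting path of length one; so every edge of G has a
-- matched or a free endpoint, and any matching of G has at most 2|M| + #free edges.
-- To bound #free, count the kernel edges at free vertices. Each free vertex has kernel degree at
-- least (1 − ε)c, and all its kernel neighbours are matched. For an edge ab of M, if a has a free
-- neighbour u then u is the only free neighbour of b (another one, w, would give the augmenting
-- path u a b w), while b itself is a non-free neighbour of a; so a and b together have at most
-- deg a or deg b ≤ (1 + ε)c free neighbours. Hence #free (1 − ε) ≤ |M| (1 + ε).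

open import Defs

open import Data.Bool using (Bool; true; false; not; _∧_; if_then_else_)
open import Data.Empty using (⊥; ⊥-elim)
open import Data.Fin using (Fin; zero; suc; _≟_)
open import Data.Fin.Properties using (suc-injective)
open import Data.Integer as ℤ using (+_)
import Data.Integer.Properties as ℤ
open import Data.List using (List; []; _∷_; length; map; tabulate)
open import Data.List.Membership.Propositional using (_∈_)
open import Data.List.Relation.Unary.All as All using (All; []; _∷_)
open import Data.List.Relation.Unary.AllPairs using ([]; _∷_)
open import Data.List.Relation.Unary.Any as Any using (Any; here; there; any?)
open import Data.List.Relation.Unary.Unique.Propositional using (Unique)
open import Data.Nat as ℕ using (ℕ; zero; suc; z≤n; s≤s; _∸_)
open import Data.Nat.Coprimality using (1-coprimeTo) renaming (sym to coprime-sym)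
open import Data.Nat.ListAction using (sum)
import Data.Nat.Properties as ℕ
open import Algebra.Properties.CommutativeSemigroup ℕ.+-commutativeSemigroup using (x∙yz≈y∙xz)
open import Algebra.Properties.Semiring.Sum ℕ.+-*-semiring
  using (sum-syntax; ∑-comm; ∑-distrib-+; *-distribˡ-sum; sum-cong-≗; sum-replicate-zero)
open import Data.Product using (_×_; _,_; proj₁; proj₂; ∃)
open import Data.Rational
  using (ℚ; mkℚ; _/_; _+_; _*_; _-_; -_; _≤_; _<_; 0ℚ; 1ℚ; *≤*; *<*; positive; nonNegative)
open import Data.Rational.Properties
  using ( normalize-coprime; module ≤-Reasoning; ≤-trans; ≤-reflexive; <-trans; <-≤-trans; <⇒≤
        ; +-identityʳ; +-inverseʳ; +-mono-≤; +-monoˡ-≤; +-monoʳ-≤; +-monoˡ-<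
        ; *-assoc; *-identityˡ; *-zeroˡ; *-distribʳ-+; *-cancelʳ-≤-pos; *-monoʳ-<-pos
        ; positive⁻¹; nonNegative⁻¹; nonNeg*nonNeg⇒nonNeg)
open import Data.Rational.Solver using (module +-*-Solver)
open import Data.Sum as Sum using (_⊎_; inj₁; inj₂)
open import Data.Unit using (tt)
open import Data.Vec.Functional using (updateAt)
open import Data.Vec.Functional.Properties using (updateAt-updates; updateAt-minimal)
open import Function using (_∘_; const)
open import Relation.Binary.PropositionalEquality as ≡
  using (_≡_; _≢_; refl; cong; cong₂; subst; subst₂)
open import Relation.Nullary using (¬_; does; yes; no; contradiction)
open import Relation.Nullary.Decidable using (dec-true; dec-false)

toℚ-coprime : ∀ k → toℚ k ≡ mkℚ (+ k) 0 (coprime-sym (1-coprimeTo k))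
toℚ-coprime k = normalize-coprime (coprime-sym (1-coprimeTo k))

toℚ-+ : ∀ a b → toℚ (a ℕ.+ b) ≡ toℚ a + toℚ b
toℚ-+ a b rewrite toℚ-coprime a | toℚ-coprime b = cong (_/ 1) numerators
  where
  numerators : + a ℤ.+ + b ≡ + a ℤ.* + 1 ℤ.+ + b ℤ.* + 1
  numerators = ≡.sym (cong₂ ℤ._+_ (ℤ.*-identityʳ (+ a)) (ℤ.*-identityʳ (+ b)))

toℚ-mono : ∀ {a b} → a ℕ.≤ b → toℚ a ≤ toℚ b
toℚ-mono {a} {b} a≤b rewrite toℚ-coprime a | toℚ-coprime b =
  *≤* (subst₂ ℤ._≤_ (≡.sym (ℤ.*-identityʳ (+ a))) (≡.sym (ℤ.*-identityʳ (+ b)))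
                    (ℤ.+≤+ a≤b))

p<q⇒0<q-p : ∀ {p q} → p < q → 0ℚ < q - p
p<q⇒0<q-p {p} {q} p<q = subst (_< q - p) (+-inverseʳ p) (+-monoˡ-< (- p) p<q)

p≤q⇒0≤q-p : ∀ {p q} → p ≤ q → 0ℚ ≤ q - p
p≤q⇒0≤q-p {p} {q} p≤q = subst (_≤ q - p) (+-inverseʳ p) (+-monoˡ-≤ (- p) p≤q)

p≤p+q : ∀ {p q} → 0ℚ ≤ q → p ≤ p + q
p≤p+q {p} {q} 0≤q = subst (_≤ p + q) (+-identityʳ p) (+-monoʳ-≤ p 0≤q)

0≤p*q : ∀ {p q} → 0ℚ ≤ p → 0ℚ ≤ q → 0ℚ ≤ p * q
0≤p*q {p} {q} 0≤p 0≤q =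
  nonNegative⁻¹ (p * q) {{nonNeg*nonNeg⇒nonNeg p {{nonNegative 0≤p}} q {{nonNegative 0≤q}}}}

-- (1 + ε) / (1 − ε) ≤ 1 + 3ε as long as ε ≤ 1/3.
≤-1+3ε : ∀ {ε c m t} → 0ℚ ≤ ε → ε < + 1 / 3 → 0ℚ < c → 0ℚ ≤ m
         → t * ((1ℚ - ε) * c) ≤ m * ((1ℚ + ε) * c) → t ≤ (1ℚ + + 3 / 1 * ε) * m
≤-1+3ε {ε} {c} {m} {t} 0≤ε ε<⅓ 0<c 0≤m t[1-ε]c≤m[1+ε]c =
  *-cancelʳ-≤-pos (1ℚ - ε) {{positive 0<1-ε}} (begin
    t * (1ℚ - ε)                                   ≤⟨ t[1-ε]≤m[1+ε] ⟩
    m * (1ℚ + ε)                                   ≤⟨ p≤p+q (0≤p*q 0≤m (0≤p*q 0≤ε 0≤1-3ε)) ⟩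
    m * (1ℚ + ε) + m * (ε * (1ℚ - + 3 / 1 * ε))    ≡⟨ expand m ε ⟩
    (1ℚ + + 3 / 1 * ε) * m * (1ℚ - ε)              ∎)
  where
  open ≤-Reasoning
  open +-*-Solver
  ⅓<1 : + 1 / 3 < 1ℚ
  ⅓<1 = *<* (ℤ.+<+ (s≤s (s≤s z≤n)))
  0<1-ε : 0ℚ < 1ℚ - ε
  0<1-ε = p<q⇒0<q-p (<-trans ε<⅓ ⅓<1)
  0≤1-3ε : 0ℚ ≤ 1ℚ - + 3 / 1 * ε
  0≤1-3ε = p≤q⇒0≤q-p (<⇒≤ (*-monoʳ-<-pos (+ 3 / 1) ε<⅓))
  t[1-ε]≤m[1+ε] : t * (1ℚ - ε) ≤ m * (1ℚ + ε)
  t[1-ε]≤m[1+ε] = *-cancelʳ-≤-pos c {{positive 0<c}} (begin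
    t * (1ℚ - ε) * c         ≡⟨ *-assoc t _ c ⟩
    t * ((1ℚ - ε) * c)       ≤⟨ t[1-ε]c≤m[1+ε]c ⟩
    m * ((1ℚ + ε) * c)       ≡⟨ *-assoc m _ c ⟨
    m * (1ℚ + ε) * c         ∎)
  expand : ∀ m ε → m * (1ℚ + ε) + m * (ε * (1ℚ - + 3 / 1 * ε))
                   ≡ (1ℚ + + 3 / 1 * ε) * m * (1ℚ - ε)
  expand = solve 2 (λ m e → m :* (con 1ℚ :+ e) :+ m :* (e :* (con 1ℚ :- con (+ 3 / 1) :* e))
                         := (con 1ℚ :+ con (+ 3 / 1) :* e) :* m :* (con 1ℚ :- e)) refl

[_] : Bool → ℕ
[ b ] = if b then 1 else 0

[b]≤1 : ∀ b → [ b ] ℕ.≤ 1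
[b]≤1 true  = ℕ.≤-refl
[b]≤1 false = z≤n

[b]*≤ : ∀ b x → [ b ] ℕ.* x ℕ.≤ x
[b]*≤ true  x = ℕ.≤-reflexive (ℕ.+-identityʳ x)
[b]*≤ false x = z≤n

[a]*[b]≢0 : ∀ a b → [ a ] ℕ.* [ b ] ≢ 0 → a ≡ true × b ≡ true
[a]*[b]≢0 true  true  _  = refl , refl
[a]*[b]≢0 true  false ≢0 = ⊥-elim (≢0 refl)
[a]*[b]≢0 false _     ≢0 = ⊥-elim (≢0 refl)

not-∧-true : ∀ {a b} → not a ∧ b ≡ true → a ≡ false × b ≡ true
not-∧-true {false} {true} refl = refl , refl

∑-mono-≤ : ∀ {n} {f g : Fin n → ℕ} → (∀ i → f i ℕ.≤ g i)
           → ∑[ i < n ] f i ℕ.≤ ∑[ i < n ] g i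
∑-mono-≤ {zero}  f≤g = z≤n
∑-mono-≤ {suc n} f≤g = ℕ.+-mono-≤ (f≤g zero) (∑-mono-≤ (f≤g ∘ suc))

∑-mono-< : ∀ {n} {f g : Fin n → ℕ} (j : Fin n) → (∀ i → f i ℕ.≤ g i) → f j ℕ.< g j
           → ∑[ i < n ] f i ℕ.< ∑[ i < n ] g i
∑-mono-< zero    f≤g fj<gj = ℕ.+-mono-<-≤ fj<gj (∑-mono-≤ (f≤g ∘ suc))
∑-mono-< (suc j) f≤g fj<gj = ℕ.+-mono-≤-< (f≤g zero) (∑-mono-< j (f≤g ∘ suc) fj<gj)

∑-zero : ∀ {n} {f : Fin n → ℕ} → (∀ i → f i ≡ 0) → ∑[ i < n ] f i ≡ 0
∑-zero {n} f≡0 = ≡.trans (sum-cong-≗ f≡0) (sum-replicate-zero n)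

∑-single : ∀ {n} {f : Fin n → ℕ} (j : Fin n) → (∀ i → i ≢ j → f i ≡ 0)
           → ∑[ i < n ] f i ≡ f j
∑-single {f = f} zero    f≡0 =
  ≡.trans (cong (f zero ℕ.+_) (∑-zero (λ i → f≡0 (suc i) λ ()))) (ℕ.+-identityʳ (f zero))
∑-single {f = f} (suc j) f≡0 =
  cong₂ ℕ._+_ (f≡0 zero λ ()) (∑-single j (λ i i≢j → f≡0 (suc i) (i≢j ∘ suc-injective)))

∑≢0⇒∃≢0 : ∀ {n} (f : Fin n → ℕ) → ∑[ i < n ] f i ≢ 0 → ∃ λ i → f i ≢ 0
∑≢0⇒∃≢0 {zero}  f ∑≢0 = ⊥-elim (∑≢0 refl)
∑≢0⇒∃≢0 {suc n} f ∑≢0 with f zero ℕ.≟ 0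
... | no  f0≢0 = zero , f0≢0
... | yes f0≡0 with ∑≢0⇒∃≢0 (f ∘ suc) (∑≢0 ∘ cong₂ ℕ._+_ f0≡0)
...   | i , fi≢0 = suc i , fi≢0

∑-updateAt-0 : ∀ {n} (g : Fin n → ℕ) (x : Fin n)
               → ∑[ i < n ] g i ≡ g x ℕ.+ ∑[ i < n ] updateAt g x (const 0) i
∑-updateAt-0 g zero    = refl
∑-updateAt-0 g (suc x) =
  ≡.trans (cong (g zero ℕ.+_) (∑-updateAt-0 (g ∘ suc) x)) (x∙yz≈y∙xz (g zero) (g (suc x)) _)

sum-map-mono : ∀ {A : Set} {g h : A → ℕ} (xs : List A) → All (λ x → g x ℕ.≤ h x) xs
               → sum (map g xs) ℕ.≤ sum (map h xs)
sum-map-mono []       []          = z≤n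
sum-map-mono (x ∷ xs) (gx≤hx ∷ p) = ℕ.+-mono-≤ gx≤hx (sum-map-mono xs p)

length≤sum-map : ∀ {A : Set} {g : A → ℕ} (xs : List A) → All (λ x → 1 ℕ.≤ g x) xs
                 → length xs ℕ.≤ sum (map g xs)
length≤sum-map []       []         = z≤n
length≤sum-map (x ∷ xs) (1≤gx ∷ p) = ℕ.+-mono-≤ 1≤gx (length≤sum-map xs p)

sum-map≤length : ∀ {A : Set} {g : A → ℕ} (xs : List A) → (∀ x → g x ℕ.≤ 1)
                 → sum (map g xs) ℕ.≤ length xs
sum-map≤length []       g≤1 = z≤n
sum-map≤length (x ∷ xs) g≤1 = ℕ.+-mono-≤ (g≤1 x) (sum-map≤length xs g≤1)

sum-map-tabulate : ∀ {n} {A : Set} (g : Fin n → A) (f : A → ℕ)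
                   → sum (map f (tabulate g)) ≡ ∑[ i < n ] f (g i)
sum-map-tabulate {zero}  g f = refl
sum-map-tabulate {suc n} g f = cong (f (g zero) ℕ.+_) (sum-map-tabulate (g ∘ suc) f)

∑≤sum-map : ∀ {n} (g : Fin n → ℕ) (xs : List (Fin n)) → (∀ v → ¬ Any (_≡ v) xs → g v ≡ 0)
            → ∑[ v < n ] g v ℕ.≤ sum (map g xs)
∑≤sum-map g []       g≡0 = ℕ.≤-reflexive (∑-zero (λ v → g≡0 v λ ()))
∑≤sum-map g (x ∷ xs) g≡0 = begin
  ∑[ v < _ ] g v            ≡⟨ ∑-updateAt-0 g x ⟩
  g x ℕ.+ ∑[ v < _ ] g′ v   ≤⟨ ℕ.+-monoʳ-≤ (g x) (∑≤sum-map g′ xs g′≡0) ⟩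
  g x ℕ.+ sum (map g′ xs)   ≤⟨ ℕ.+-monoʳ-≤ (g x) (sum-map-mono xs (All.universal g′≤g xs)) ⟩
  g x ℕ.+ sum (map g xs)    ∎
  where
  open ℕ.≤-Reasoning
  g′ = updateAt g x (const 0)
  g′≤g : ∀ v → g′ v ℕ.≤ g v
  g′≤g v with v ≟ x
  ... | yes refl = subst (ℕ._≤ g v) (≡.sym (updateAt-updates v g)) z≤n
  ... | no  v≢x  = ℕ.≤-reflexive (updateAt-minimal v x g v≢x)
  g′≡0 : ∀ v → ¬ Any (_≡ v) xs → g′ v ≡ 0
  g′≡0 v v∉xs with v ≟ x
  ... | yes refl = updateAt-updates v g
  ... | no  v≢x  = ≡.trans (updateAt-minimal v x g v≢x)
                     (g≡0 v λ { (here x≡v) → v≢x (≡.sym x≡v) ; (there v∈xs) → v∉xs v∈xs })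

sum-map≤∑ : ∀ {n} (g : Fin n → ℕ) (xs : List (Fin n)) → Unique xs
            → sum (map g xs) ℕ.≤ ∑[ v < n ] g v
sum-map≤∑ g []       []              = z≤n
sum-map≤∑ g (x ∷ xs) (x∉xs ∷ unique) = begin
  g x ℕ.+ sum (map g xs)    ≤⟨ ℕ.+-monoʳ-≤ (g x) (sum-map-mono xs (All.map g≤g′ x∉xs)) ⟩
  g x ℕ.+ sum (map g′ xs)   ≤⟨ ℕ.+-monoʳ-≤ (g x) (sum-map≤∑ g′ xs unique) ⟩
  g x ℕ.+ ∑[ v < _ ] g′ v   ≡⟨ ∑-updateAt-0 g x ⟨
  ∑[ v < _ ] g v            ∎
  where
  open ℕ.≤-Reasoning
  g′ = updateAt g x (const 0)
  g≤g′ : ∀ {y} → x ≢ y → g y ℕ.≤ g′ y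
  g≤g′ x≢y = ℕ.≤-reflexive (≡.sym (updateAt-minimal _ x g (x≢y ∘ ≡.sym)))

∑*≤∑ : ∀ {n} (c h : Fin n → ℕ) (L : ℚ) → (∀ i → toℚ (c i) * L ≤ toℚ (h i))
       → toℚ (∑[ i < n ] c i) * L ≤ toℚ (∑[ i < n ] h i)
∑*≤∑ {zero}  c h L cL≤h = ≤-reflexive (*-zeroˡ L)
∑*≤∑ {suc n} c h L cL≤h = begin
  toℚ (c zero ℕ.+ ∑c) * L          ≡⟨ cong (_* L) (toℚ-+ (c zero) ∑c) ⟩
  (toℚ (c zero) + toℚ ∑c) * L      ≡⟨ *-distribʳ-+ L (toℚ (c zero)) (toℚ ∑c) ⟩
  toℚ (c zero) * L + toℚ ∑c * L    ≤⟨ +-mono-≤ (cL≤h zero) (∑*≤∑ _ _ L (cL≤h ∘ suc)) ⟩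
  toℚ (h zero) + toℚ ∑h            ≡⟨ toℚ-+ (h zero) ∑h ⟨
  toℚ (h zero ℕ.+ ∑h)              ∎
  where
  open ≤-Reasoning
  ∑c = ∑[ i < n ] c (suc i)
  ∑h = ∑[ i < n ] h (suc i)

sum≤length* : ∀ {A : Set} (g : A → ℕ) (L : ℚ) (xs : List A) → All (λ x → toℚ (g x) ≤ L) xs
              → toℚ (sum (map g xs)) ≤ toℚ (length xs) * L
sum≤length* g L []       []          = ≤-reflexive (≡.sym (*-zeroˡ L))
sum≤length* g L (x ∷ xs) (gx≤L ∷ p) = begin
  toℚ (g x ℕ.+ s)                  ≡⟨ toℚ-+ (g x) s ⟩
  toℚ (g x) + toℚ s                ≤⟨ +-mono-≤ gx≤L (sum≤length* g L xs p) ⟩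
  L + toℚ (length xs) * L          ≡⟨ cong (_+ toℚ (length xs) * L) (*-identityˡ L) ⟨
  1ℚ * L + toℚ (length xs) * L     ≡⟨ *-distribʳ-+ L 1ℚ (toℚ (length xs)) ⟨
  (1ℚ + toℚ (length xs)) * L       ≡⟨ cong (_* L) (toℚ-+ 1 (length xs)) ⟨
  toℚ (suc (length xs)) * L        ∎
  where
  open ≤-Reasoning
  s = sum (map g xs)

deg≡∑ : ∀ {n} (K : EdgeSet n) v → deg K v ≡ ∑[ u < n ] [ K u v ]
deg≡∑ K v = sum-map-tabulate (λ u → u) (λ u → [ K u v ])

sum-map-endpoints : ∀ {n} (g : Fin n → ℕ) (N : Matching n)
                    → sum (map g (endpoints N)) ≡ sum (map (λ e → g (proj₁ e) ℕ.+ g (proj₂ e)) N)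
sum-map-endpoints g []            = refl
sum-map-endpoints g ((a , b) ∷ N) =
  ≡.trans (≡.sym (ℕ.+-assoc (g a) (g b) _)) (cong (g a ℕ.+ g b ℕ.+_) (sum-map-endpoints g N))

length-endpoints : ∀ {n} (N : Matching n) → length (endpoints N) ≡ length N ℕ.+ length N
length-endpoints []      = refl
length-endpoints (_ ∷ N) =
  cong suc (≡.trans (cong suc (length-endpoints N)) (≡.sym (ℕ.+-suc (length N) (length N))))

InM⇒Matched : ∀ {n} {N : Matching n} {x y} → InM N x y → Matched N x
InM⇒Matched {N = _ ∷ _} (here (inj₁ refl)) = here refl
InM⇒Matched {N = _ ∷ _} (here (inj₂ refl)) = there (here refl)
InM⇒Matched {N = _ ∷ _} (there p)          = there (there (InM⇒Matched p))

InM-sym : ∀ {n} {N : Matching n} {x y} → InM N x y → InM N y x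
InM-sym = Any.map Sum.swap

∈⇒InM : ∀ {n} {N : Matching n} {x y} → (x , y) ∈ N → InM N x y
∈⇒InM = Any.map (inj₁ ∘ ≡.sym)

unmatched≢matched : ∀ {n} {N : Matching n} {u a} → ¬ Matched N u → Matched N a → u ≢ a
unmatched≢matched ¬Mu Ma refl = ¬Mu Ma

module KernelMatching {n} {G : Graph n} {ε c : ℚ} (κ : Kernel G ε c) (M : Matching n)
  (M⊆κ : All (λ e → kE κ (proj₁ e) (proj₂ e) ≡ true) M)
  (no-short-augmenting : ∀ ps → AugmentingPath (kE κ) M ps → 5 ℕ.≤ length ps ∸ 1) where

  K : EdgeSet n
  K = kE κ

  K-irrefl : ∀ {x y} → K x y ≡ true → x ≢ y
  K-irrefl {x} Kxx refl with ≡.trans (≡.sym (kE⊆E κ x x Kxx)) (irrefl G x)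
  ... | ()

  no-augmenting-edge : ∀ {x y} → K x y ≡ true → ¬ Matched M x → ¬ Matched M y → ⊥
  no-augmenting-edge {x} {y} Kxy ¬Mx ¬My =
    contradiction (no-short-augmenting _ path) λ { (s≤s ()) }
    where
    path : AugmentingPath K M (x ∷ y ∷ [])
    path = ((K-irrefl Kxy ∷ []) ∷ [] ∷ [])
         , s≤s (s≤s z≤n)
         , (Kxy , ¬Mx ∘ InM⇒Matched , tt)
         , (λ { _ refl → ¬Mx }) , (λ { _ refl → ¬My })

  no-augmenting-3-path : ∀ {u a b w} → u ≢ w → ¬ Matched M u → ¬ Matched M w
                         → K u a ≡ true → (a , b) ∈ M → K b w ≡ true → ⊥
  no-augmenting-3-path {u} {a} {b} {w} u≢w ¬Mu ¬Mw Kua ab∈M Kbw =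
    contradiction (no-short-augmenting _ path) λ { (s≤s (s≤s (s≤s ()))) }
    where
    Mab : InM M a b
    Mab = ∈⇒InM ab∈M
    Ma : Matched M a
    Ma = InM⇒Matched Mab
    Mb : Matched M b
    Mb = InM⇒Matched (InM-sym Mab)
    path : AugmentingPath K M (u ∷ a ∷ b ∷ w ∷ [])
    path = ( (unmatched≢matched ¬Mu Ma ∷ unmatched≢matched ¬Mu Mb ∷ u≢w ∷ [])
           ∷ (K-irrefl (All.lookup M⊆κ ab∈M) ∷ (unmatched≢matched ¬Mw Ma ∘ ≡.sym) ∷ [])
           ∷ ((unmatched≢matched ¬Mw Mb ∘ ≡.sym) ∷ []) ∷ [] ∷ [])
         , s≤s (s≤s z≤n)
         , ( Kua , ¬Mu ∘ InM⇒Matched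
           , All.lookup M⊆κ ab∈M , Mab
           , Kbw , ¬Mw ∘ InM⇒Matched ∘ InM-sym , tt)
         , (λ { _ refl → ¬Mu }) , (λ { _ refl → ¬Mw })

  matched : Fin n → Bool
  matched v = does (any? (_≟ v) (endpoints M))

  free : Fin n → Bool
  free v = not (matched v) ∧ tight κ v

  matched-true : ∀ {v} → Matched M v → matched v ≡ true
  matched-true {v} = dec-true (any? (_≟ v) (endpoints M))

  matched-false⇒unmatched : ∀ {v} → matched v ≡ false → ¬ Matched M v
  matched-false⇒unmatched mv≡false Mv with ≡.trans (≡.sym mv≡false) (matched-true Mv)
  ... | ()

  free⇒unmatched : ∀ {v} → free v ≡ true → ¬ Matched M v
  free⇒unmatched fv = matched-false⇒unmatched (proj₁ (not-∧-true fv))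

  free⇒tight : ∀ {v} → free v ≡ true → tight κ v ≡ true
  free⇒tight fv = proj₂ (not-∧-true fv)

  freeDeg : Fin n → ℕ
  freeDeg w = ∑[ u < n ] ([ free u ] ℕ.* [ K u w ])

  freeDeg≤deg : ∀ w → freeDeg w ℕ.≤ deg K w
  freeDeg≤deg w =
    subst (freeDeg w ℕ.≤_) (≡.sym (deg≡∑ K w)) (∑-mono-≤ λ u → [b]*≤ (free u) [ K u w ])

  freeDeg<deg : ∀ {b w} → Matched M b → K b w ≡ true → freeDeg w ℕ.< deg K w
  freeDeg<deg {b} {w} Mb Kbw = subst (freeDeg w ℕ.<_) (≡.sym (deg≡∑ K w))
    (∑-mono-< b (λ u → [b]*≤ (free u) [ K u w ]) b-not-counted)
    where
    b-not-counted : [ free b ] ℕ.* [ K b w ] ℕ.< [ K b w ]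
    b-not-counted rewrite matched-true Mb | Kbw = s≤s z≤n

  freeDeg-unmatched : ∀ {w} → ¬ Matched M w → freeDeg w ≡ 0
  freeDeg-unmatched {w} ¬Mw = ∑-zero no-free-neighbour
    where
    no-free-neighbour : ∀ u → [ free u ] ℕ.* [ K u w ] ≡ 0
    no-free-neighbour u with free u in fu | K u w in Kuw
    ... | true  | true  = ⊥-elim (no-augmenting-edge Kuw (free⇒unmatched fu) ¬Mw)
    ... | true  | false = refl
    ... | false | _     = refl

  freeDeg-partner≤1 : ∀ {u a b} → free u ≡ true → K u a ≡ true → (a , b) ∈ M → freeDeg b ℕ.≤ 1
  freeDeg-partner≤1 {u} {a} {b} fu Kua ab∈M = begin
    freeDeg b                  ≡⟨ ∑-single u only-u ⟩
    [ free u ] ℕ.* [ K u b ]   ≤⟨ [b]*≤ (free u) [ K u b ] ⟩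
    [ K u b ]                  ≤⟨ [b]≤1 (K u b) ⟩
    1                          ∎
    where
    open ℕ.≤-Reasoning
    only-u : ∀ w → w ≢ u → [ free w ] ℕ.* [ K w b ] ≡ 0
    only-u w w≢u with free w in fw | K w b in Kwb
    ... | true  | true  = ⊥-elim (no-augmenting-3-path (w≢u ∘ ≡.sym) (free⇒unmatched fu)
                                    (free⇒unmatched fw) Kua ab∈M (≡.trans (kE-sym κ b w) Kwb))
    ... | true  | false = refl
    ... | false | _     = refl

  freeDeg-edge : ∀ {a b} → (a , b) ∈ M
                 → freeDeg a ℕ.+ freeDeg b ℕ.≤ deg K a ⊎ freeDeg a ℕ.+ freeDeg b ℕ.≤ deg K b
  freeDeg-edge {a} {b} ab∈M with freeDeg a ℕ.≟ 0
  ... | yes fa≡0 = inj₂ (subst (λ x → x ℕ.+ freeDeg b ℕ.≤ deg K b) (≡.sym fa≡0) (freeDeg≤deg b))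
  ... | no  fa≢0 with ∑≢0⇒∃≢0 _ fa≢0
  ...   | u , term≢0 = inj₁ (begin
    freeDeg a ℕ.+ freeDeg b   ≤⟨ ℕ.+-monoʳ-≤ (freeDeg a) (freeDeg-partner≤1 fu Kua ab∈M) ⟩
    freeDeg a ℕ.+ 1           ≡⟨ ℕ.+-comm (freeDeg a) 1 ⟩
    suc (freeDeg a)           ≤⟨ freeDeg<deg (InM⇒Matched (InM-sym (∈⇒InM ab∈M))) Kba ⟩
    deg K a                   ∎)
    where
    open ℕ.≤-Reasoning
    fu = proj₁ ([a]*[b]≢0 (free u) (K u a) term≢0)
    Kua = proj₂ ([a]*[b]≢0 (free u) (K u a) term≢0)
    Kba = ≡.trans (kE-sym κ b a) (All.lookup M⊆κ ab∈M)

  ∑-free-deg : ∑[ u < n ] ([ free u ] ℕ.* deg K u) ≡ ∑[ w < n ] freeDeg w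
  ∑-free-deg = begin
    ∑[ u < n ] ([ free u ] ℕ.* deg K u)
      ≡⟨ sum-cong-≗ (λ u → cong ([ free u ] ℕ.*_) (deg≡∑ K u)) ⟩
    ∑[ u < n ] ([ free u ] ℕ.* ∑[ w < n ] [ K w u ])
      ≡⟨ sum-cong-≗ (λ u → *-distribˡ-sum [ free u ] (λ w → [ K w u ])) ⟩
    ∑[ u < n ] ∑[ w < n ] ([ free u ] ℕ.* [ K w u ])
      ≡⟨ sum-cong-≗ (λ u → sum-cong-≗ λ w → cong (λ b → [ free u ] ℕ.* [ b ]) (kE-sym κ w u)) ⟩
    ∑[ u < n ] ∑[ w < n ] ([ free u ] ℕ.* [ K u w ])
      ≡⟨ ∑-comm (λ u w → [ free u ] ℕ.* [ K u w ]) ⟩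
    ∑[ w < n ] freeDeg w
      ∎
    where open ≡.≡-Reasoning

  ∑-freeDeg≤ : toℚ (∑[ w < n ] freeDeg w) ≤ toℚ (length M) * ((1ℚ + ε) * c)
  ∑-freeDeg≤ = begin
    toℚ (∑[ w < n ] freeDeg w)
      ≤⟨ toℚ-mono (∑≤sum-map freeDeg (endpoints M) λ _ → freeDeg-unmatched) ⟩
    toℚ (sum (map freeDeg (endpoints M)))
      ≡⟨ cong toℚ (sum-map-endpoints freeDeg M) ⟩
    toℚ (sum (map (λ e → freeDeg (proj₁ e) ℕ.+ freeDeg (proj₂ e)) M))
      ≤⟨ sum≤length* _ _ M (All.tabulate edge≤) ⟩
    toℚ (length M) * ((1ℚ + ε) * c)
      ∎
    where
    open ≤-Reasoning
    edge≤ : ∀ {e} → e ∈ M → toℚ (freeDeg (proj₁ e) ℕ.+ freeDeg (proj₂ e)) ≤ (1ℚ + ε) * c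
    edge≤ {a , b} ab∈M = Sum.[ bound , bound ]′ (freeDeg-edge ab∈M)
      where
      bound : ∀ {v} → freeDeg a ℕ.+ freeDeg b ℕ.≤ deg K v
              → toℚ (freeDeg a ℕ.+ freeDeg b) ≤ (1ℚ + ε) * c
      bound {v} ≤deg = ≤-trans (toℚ-mono ≤deg) (upper κ v)

  #free : ℕ
  #free = ∑[ u < n ] [ free u ]

  #free≤ : toℚ #free * ((1ℚ - ε) * c) ≤ toℚ (length M) * ((1ℚ + ε) * c)
  #free≤ = begin
    toℚ #free * ((1ℚ - ε) * c)                  ≤⟨ ∑*≤∑ _ _ _ tight-degree ⟩
    toℚ (∑[ u < n ] ([ free u ] ℕ.* deg K u))   ≡⟨ cong toℚ ∑-free-deg ⟩
    toℚ (∑[ w < n ] freeDeg w)                  ≤⟨ ∑-freeDeg≤ ⟩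
    toℚ (length M) * ((1ℚ + ε) * c)             ∎
    where
    open ≤-Reasoning
    tight-degree : ∀ u → toℚ [ free u ] * ((1ℚ - ε) * c) ≤ toℚ ([ free u ] ℕ.* deg K u)
    tight-degree u with free u in fu
    ... | true  = subst₂ _≤_ (≡.sym (*-identityˡ ((1ℚ - ε) * c)))
                    (cong toℚ (≡.sym (ℕ.+-identityʳ (deg K u)))) (lower κ u (free⇒tight fu))
    ... | false = ≤-reflexive (*-zeroˡ ((1ℚ - ε) * c))

  cover : Fin n → ℕ
  cover v = [ matched v ] ℕ.+ [ free v ]

  cover-edge : ∀ {x y} → adj G x y ≡ true → 1 ℕ.≤ cover x ℕ.+ cover y
  cover-edge {x} {y} Gxy with matched x in mx | tight κ x in tx | matched y in my | tight κ y in ty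
  ... | true  | _     | _     | _     = s≤s z≤n
  ... | false | true  | _     | _     = s≤s z≤n
  ... | false | false | true  | _     = s≤s z≤n
  ... | false | false | false | true  = s≤s z≤n
  ... | false | false | false | false = ⊥-elim (no-augmenting-edge (slackAll κ x y Gxy tx ty)
                                          (matched-false⇒unmatched mx) (matched-false⇒unmatched my))

  #matched≤ : ∑[ v < n ] [ matched v ] ℕ.≤ length M ℕ.+ length M
  #matched≤ = begin
    ∑[ v < n ] [ matched v ]
      ≤⟨ ∑≤sum-map _ (endpoints M) (λ v → cong [_] ∘ dec-false (any? (_≟ v) (endpoints M))) ⟩
    sum (map (λ v → [ matched v ]) (endpoints M))
      ≤⟨ sum-map≤length (endpoints M) ([b]≤1 ∘ matched) ⟩
    length (endpoints M)
      ≡⟨ length-endpoints M ⟩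
    length M ℕ.+ length M
      ∎
    where open ℕ.≤-Reasoning

  matching≤ : ∀ (N : Matching n) → IsMatchingIn (adj G) N
              → length N ℕ.≤ length M ℕ.+ length M ℕ.+ #free
  matching≤ N (N⊆G , unique) = begin
    length N
      ≤⟨ length≤sum-map N (All.map cover-edge N⊆G) ⟩
    sum (map (λ e → cover (proj₁ e) ℕ.+ cover (proj₂ e)) N)
      ≡⟨ sum-map-endpoints cover N ⟨
    sum (map cover (endpoints N))
      ≤⟨ sum-map≤∑ cover (endpoints N) unique ⟩
    ∑[ v < n ] cover v
      ≡⟨ ∑-distrib-+ (λ v → [ matched v ]) (λ v → [ free v ]) ⟩
    ∑[ v < n ] [ matched v ] ℕ.+ #free
      ≤⟨ ℕ.+-monoˡ-≤ #free #matched≤ ⟩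
    length M ℕ.+ length M ℕ.+ #free
      ∎
    where open ℕ.≤-Reasoning

theorem3p10 : ∀ {n} (G : Graph n) (c ε : ℚ) → 1ℚ ≤ c → 0ℚ ≤ ε → ε < + 1 / 3
    → (κ : Kernel G ε c) (M : Matching n) → IsMatchingIn (kE κ) M
    → (∀ (ps : List (Fin n)) → AugmentingPath (kE κ) M ps → 5 ℕ.≤ length ps ∸ 1)
    → ∀ (M′ : Matching n) → IsMatchingIn (adj G) M′
    → toℚ (length M′) ≤ (+ 3 / 1 + + 3 / 1 * ε) * toℚ (length M)
theorem3p10 G c ε 1≤c 0≤ε ε<⅓ κ M (M⊆κ , _) no-short-augmenting M′ M′-matching = begin
  toℚ (length M′)                             ≤⟨ toℚ-mono (matching≤ M′ M′-matching) ⟩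
  toℚ (m ℕ.+ m ℕ.+ #free)                     ≡⟨ toℚ-+ (m ℕ.+ m) #free ⟩
  toℚ (m ℕ.+ m) + toℚ #free                   ≡⟨ cong (_+ toℚ #free) (toℚ-+ m m) ⟩
  toℚ m + toℚ m + toℚ #free                   ≤⟨ +-monoʳ-≤ (toℚ m + toℚ m) #free≤[1+3ε]m ⟩
  toℚ m + toℚ m + (1ℚ + + 3 / 1 * ε) * toℚ m  ≡⟨ collect (toℚ m) ε ⟩
  (+ 3 / 1 + + 3 / 1 * ε) * toℚ m             ∎
  where
  open KernelMatching κ M M⊆κ no-short-augmenting
  open ≤-Reasoning
  open +-*-Solver
  m = length M
  #free≤[1+3ε]m : toℚ #free ≤ (1ℚ + + 3 / 1 * ε) * toℚ m
  #free≤[1+3ε]m =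
    ≤-1+3ε 0≤ε ε<⅓ (<-≤-trans (positive⁻¹ 1ℚ) 1≤c) (toℚ-mono {b = m} z≤n) #free≤
  collect : ∀ x e → x + x + (1ℚ + + 3 / 1 * e) * x ≡ (+ 3 / 1 + + 3 / 1 * e) * x
  collect = solve 2 (λ x e → x :+ x :+ (con 1ℚ :+ con (+ 3 / 1) :* e) :* x
                           := (con (+ 3 / 1) :+ con (+ 3 / 1) :* e) :* x) refl
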